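{- If $G$ is a connected graph whose longest path has length $p$, then $c(G) \leq \lceil\frac{2p}{3}\rceil+3$.
   Context: The length of a path is its number of vertices. Cops and Robbers is played on a connected graph: first the cops are placed on vertices, then the robber chooses a vertex; players alternate turns (cops first), each cop/robber moving to an adjacent vertex or staying put; the cops win if a cop eventually moves onto the robber's vertex. The cop number $c(G)$ is the least number of cops guaranteeing a cop win regardless of the robber's strategy. -}

module Defs where

open import Level using (0ℓ)
open import Data.Nat using (ℕ; _+_; _*_; _≤_; _/_)
open import Data.Fin using (Fin)
open import Data.List using (List; length)
open import Data.List.Relation.Unary.Linked using (Linked)
open import Data.List.Relation.Unary.Unique.Propositional using (Unique)
open import Data.Product using (Σ; ∃; _×_)
open import Data.Sum using (_⊎_)
open import Relation.Nullary using (¬_)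
open import Relation.Binary.PropositionalEquality using (_≡_)
open import Relation.Binary.Construct.Closure.ReflexiveTransitive using (Star)

record Graph (n : ℕ) : Set₁ where
  field
    Adj       : Fin n → Fin n → Set
    symmetric : ∀ {u v} → Adj u v → Adj v u
    irreflexive : ∀ {u} → ¬ Adj u u
open Graph public

module _ {n : ℕ} (G : Graph n) where

  Connected : Set
  Connected = ∀ u v → Star (Adj G) u v

  -- a path: a list of pairwise distinct vertices, consecutive ones adjacent;
  -- its length is its number of vertices
  IsPath : List (Fin n) → Set
  IsPath xs = Unique xs × Linked (Adj G) xs

  LongestPathLength : ℕ → Set
  LongestPathLength p =
    (Σ (List (Fin n)) λ xs → IsPath xs × length xs ≡ p)
    × (∀ xs → IsPath xs → length xs ≤ p)

  Step : Fin n → Fin n → Set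
  Step u v = u ≡ v ⊎ Adj G u v

  Cops : ℕ → Set
  Cops k = Fin k → Fin n

  -- CopsWin k c r : it is the cops' turn, cops at c, robber at r, and the
  -- cops can force capture in finitely many moves (least fixed point).
  data CopsWin (k : ℕ) (c : Cops k) (r : Fin n) : Set where
    move : (c' : Cops k) → (∀ i → Step (c i) (c' i)) →
           (∃ (λ i → c' i ≡ r)
             ⊎ (∀ r' → Step r r' → CopsWin k c' r')) →
           CopsWin k c r

  KCopsWin : ℕ → Set
  KCopsWin k = Σ (Cops k) λ c → ∀ r → CopsWin k c r

  CopNumber≤ : ℕ → Set
  CopNumber≤ m = Σ ℕ λ k → k ≤ m × KCopsWin k

⌈_/3⌉ : ℕ → ℕ
⌈ a /3⌉ = (a + 2) / 3

{-# OPTIONS --safe #-}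
module Submission where

open import Defs
open import Level using (Level; 0ℓ; _⊔_)
open import Data.Nat using (ℕ; zero; suc; _+_; _*_; _∸_; _≤_; _<_; s≤s; z≤n; _/_)
open import Data.Nat.Properties
  using (module ≤-Reasoning; m≤m+n; ≤-refl; ≤-trans; ≤-reflexive; <-irrefl; <-≤-trans; n≤1+n; ∸-monoʳ-<; *-comm; *-suc; +-comm)
open import Data.Nat.DivMod using (m*n/n≡m; m*n/m*o≡n/o; /-monoˡ-≤; /-monoʳ-≤)
open import Data.Nat.Induction using (<-wellFounded)
open import Data.Fin as Fin using (Fin; toℕ; fromℕ<)
open import Data.Fin.Properties using (toℕ-fromℕ<; _≟_)
open import Data.Vec.Functional using (updateAt)
open import Data.Vec.Functional.Properties using (updateAt-updates; updateAt-minimal)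
open import Data.List using (List; []; _∷_; length)
open import Data.List.Membership.Propositional using (_∈_; _∉_)
open import Data.List.Relation.Unary.Any using (toSum)
open import Data.List.Relation.Unary.All as All using (All; []; _∷_)
open import Data.List.Relation.Unary.All.Properties using (¬Any⇒All¬)
open import Data.List.Relation.Unary.AllPairs using ([]; _∷_)
open import Data.List.Relation.Unary.Linked using ([-]; _∷_)
open import Data.Product using (∃; _×_; _,_)
open import Data.Sum using (_⊎_; inj₁; inj₂; [_,_]′; reduce)
open import Function using (const; _∘_)
open import Induction.WellFounded using (Acc; acc)
open import Relation.Nullary using (yes; no)
open import Relation.Binary.Definitions using (DecidableEquality)
open import Relation.Binary.Core using (Rel)
open import Relation.Binary.PropositionalEquality using (_≡_; _≢_; refl; sym; trans; cong; subst)
open import Relation.Binary.Construct.Closure.ReflexiveTransitive using (Star; ε; _◅_; _◅◅_; map)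

-- The cops grow a path all of whose vertices are occupied or dominated by cops
-- that never move again, so the robber can never step onto it, and they keep the
-- robber reachable from the head h of the path by a walk that never returns to the
-- path.  The cop on h dominates the next vertex w of that walk; a fresh cop walks
-- to the vertex w₂ after w, and on arrival the path becomes w₂ w h …, with the
-- fresh cop on the new head.  So each cop accounts for two path vertices: fresh
-- cop number m (counting from 0) is only called once a path on 2m + 1 vertices
-- exists, hence ⌈p/2⌉ cops suffice.  The game ends since the path cannot grow
-- beyond p vertices.

module _ {a ℓ : Level} {A : Set a} (_≟ᴬ_ : DecidableEquality A) {T : Rel A ℓ} where

  Avoiding : A → Rel A (a ⊔ ℓ)
  Avoiding z u v = T u v × v ≢ z

  lastVisit : ∀ z {u v} → Star T u v → Star (Avoiding z) u v ⊎ Star (Avoiding z) z v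
  lastVisit z ε = inj₁ ε
  lastVisit z (_◅_ {j = w} e walk) with lastVisit z walk | w ≟ᴬ z
  ... | inj₂ suffix | _        = inj₂ suffix
  ... | inj₁ walk′  | yes refl = inj₂ walk′
  ... | inj₁ walk′  | no w≢z   = inj₁ ((e , w≢z) ◅ walk′)

  fromLastVisit : ∀ {z v} → Star T z v → Star (Avoiding z) z v
  fromLastVisit {z} walk = reduce (lastVisit z walk)

∉-∷ : ∀ {a} {A : Set a} {x y : A} {xs} → x ≢ y → x ∉ xs → x ∉ y ∷ xs
∉-∷ x≢y x∉xs = [ x≢y , x∉xs ]′ ∘ toSum

2m<n⇒m<[1+n]/2 : ∀ {m n} → 2 * m < n → m < suc n / 2
2m<n⇒m<[1+n]/2 {m} {n} 2m<n = begin
  suc m              ≡⟨ m*n/n≡m (suc m) 2 ⟨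
  suc m * 2 / 2      ≤⟨ /-monoˡ-≤ 2 (s≤s (subst (_< n) (*-comm 2 m) 2m<n)) ⟩
  suc n / 2          ∎
  where open ≤-Reasoning

⌈n/2⌉≤⌈2n/3⌉ : ∀ n → suc n / 2 ≤ ⌈ 2 * n /3⌉
⌈n/2⌉≤⌈2n/3⌉ n = begin
  suc n / 2          ≡⟨ m*n/m*o≡n/o 2 (suc n) 2 ⟨
  2 * suc n / 4      ≤⟨ /-monoʳ-≤ (2 * suc n) (s≤s (s≤s (s≤s z≤n))) ⟩
  2 * suc n / 3      ≡⟨ cong (_/ 3) (trans (*-suc 2 n) (+-comm 2 (2 * n))) ⟩
  ⌈ 2 * n /3⌉        ∎
  where open ≤-Reasoning

module _ {n : ℕ} (G : Graph n) where

  Outside : List (Fin n) → Rel (Fin n) 0ℓ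
  Outside P u v = Adj G u v × v ∉ P

  outside-∷ : ∀ {P z v} → Star (Outside P) z v → Star (Outside (z ∷ P)) z v
  outside-∷ walk = map (λ { ((u~v , v∉P) , v≢z) → u~v , ∉-∷ v≢z v∉P }) (fromLastVisit _≟_ walk)

  step-outside : ∀ {P u v} → Step G u v → v ∉ P → Star (Outside P) u v
  step-outside (inj₁ refl) _   = ε
  step-outside (inj₂ u~v)  v∉P = (u~v , v∉P) ◅ ε

  IsPath-∷ : ∀ {x w xs} → Adj G x w → w ∉ x ∷ xs → IsPath G (x ∷ xs) → IsPath G (w ∷ x ∷ xs)
  IsPath-∷ x~w w∉ (unique , linked) = ¬Any⇒All¬ _ w∉ ∷ unique , symmetric G x~w ∷ linked

  moveCop : ∀ {k} → Cops G k → Fin k → Fin n → Cops G k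
  moveCop c t v = updateAt c t (const v)

  moveCop-moves : ∀ {k} (c : Cops G k) t v → moveCop c t v t ≡ v
  moveCop-moves c t v = updateAt-updates t c

  moveCop-steps : ∀ {k} {c : Cops G k} {t v} → Step G (c t) v → ∀ i → Step G (c i) (moveCop c t v i)
  moveCop-steps {c = c} {t} {v} s i with i ≟ t
  ... | yes refl = subst (Step G (c i)) (sym (moveCop-moves c i v)) s
  ... | no i≢t   = inj₁ (sym (updateAt-minimal i t c i≢t))

  capture : ∀ {k c r} (i : Fin k) → Step G (c i) r → CopsWin G k c r
  capture {c = c} {r} i s = move (moveCop c i r) (moveCop-steps s) (inj₁ (i , moveCop-moves c i r))

  Dominated : ∀ {k} → Cops G k → ℕ → Fin n → Set
  Dominated c m x = ∃ λ i → toℕ i < m × Step G (c i) x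

  Dominated-mono : ∀ {k} {c : Cops G k} {m m′ x} → m ≤ m′ → Dominated c m x → Dominated c m′ x
  Dominated-mono m≤m′ (i , i<m , s) = i , <-≤-trans i<m m≤m′ , s

  Dominated-moveCop : ∀ {k} {c : Cops G k} {m t v x} → m ≤ toℕ t →
                      Dominated c m x → Dominated (moveCop c t v) m x
  Dominated-moveCop {c = c} {t = t} m≤t (i , i<m , s) =
    i , i<m , subst (λ u → Step G u _) (sym (updateAt-minimal i t c i≢t)) s
    where
    i≢t : i ≢ t
    i≢t refl = <-irrefl refl (<-≤-trans i<m m≤t)

  catch : ∀ {k c m P r} → All (Dominated {k} c m) P → r ∈ P → CopsWin G k c r
  catch dom r∈P with All.lookup dom r∈P
  ... | i , _ , s = capture i s

module PathGuarding {n : ℕ} (G : Graph n) (connected : Connected G)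
                    {p : ℕ} (bounded : ∀ xs → IsPath G xs → length xs ≤ p) where

  open import Data.List.Membership.DecPropositional (_≟_ {n}) using (_∈?_)

  K : ℕ
  K = suc p / 2

  freshCop : ∀ m → 2 * m < p → Fin K
  freshCop m 2m<p = fromℕ< (2m<n⇒m<[1+n]/2 {m} 2m<p)

  toℕ-freshCop : ∀ m (2m<p : 2 * m < p) → toℕ (freshCop m 2m<p) ≡ m
  toℕ-freshCop m 2m<p = toℕ-fromℕ< (2m<n⇒m<[1+n]/2 {m} 2m<p)

  headroom : ∀ {x y P} → IsPath G (x ∷ y ∷ P) → p ∸ length (x ∷ y ∷ P) < p ∸ length P
  headroom {P = P} path = ∸-monoʳ-< (s≤s (n≤1+n (length P))) (bounded _ path)

  mutual
    guard : ∀ {m c h xs r} → Acc _<_ (p ∸ length (h ∷ xs)) → IsPath G (h ∷ xs) →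
            2 * m ≤ suc (length (h ∷ xs)) → All (Dominated G c m) (h ∷ xs) →
            (∃ λ i → toℕ i < m × c i ≡ h) → Star (Outside G (h ∷ xs)) h r → CopsWin G K c r
    guard _ _ _ _ (i , _ , refl) ε = capture G i (inj₁ refl)
    guard {m} {c} {h} {xs} (acc rs) path economy dom (i , i<m , refl) ((h~w , w∉) ◅ walk)
      with outside-∷ G walk
    ... | ε = capture G i (inj₂ h~w)
    ... | (w~w₂ , w₂∉) ◅ walk′ =
      approach t (toℕ-freshCop m 2m<p) (rs (headroom path₂)) path₂ economy
               ((i , i<m , inj₂ h~w) ∷ dom) walk′ refl (connected (c t) _)
      where
      path₂ : IsPath G (_ ∷ _ ∷ h ∷ xs)
      path₂ = IsPath-∷ G w~w₂ w₂∉ (IsPath-∷ G h~w w∉ path)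
      2m<p : 2 * m < p
      2m<p = ≤-trans (s≤s economy) (bounded _ path₂)
      t : Fin K
      t = freshCop m 2m<p

    -- The travelling cop's position is abstracted as u so that the recursion on
    -- its walk is structural.
    approach : ∀ {m c w₂ w P r} (t : Fin K) → toℕ t ≡ m →
               Acc _<_ (p ∸ length (w₂ ∷ w ∷ P)) → IsPath G (w₂ ∷ w ∷ P) →
               2 * m ≤ length (w ∷ P) → All (Dominated G c m) (w ∷ P) →
               Star (Outside G (w ∷ P)) w₂ r → ∀ {u} → c t ≡ u → Star (Adj G) u w₂ → CopsWin G K c r
    approach {m} {c} {P = P} t t≡m wf path economy dom walk refl ε =
      guard wf path economy′ (arrived ∷ All.map (Dominated-mono G (n≤1+n m)) dom)
            (t , t<1+m , refl) (outside-∷ G walk)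
      where
      t<1+m : toℕ t < suc m
      t<1+m = s≤s (≤-reflexive t≡m)
      arrived : Dominated G c (suc m) (c t)
      arrived = t , t<1+m , inj₁ refl
      economy′ : 2 * suc m ≤ 3 + length P
      economy′ = subst (_≤ 3 + length P) (sym (*-suc 2 m)) (s≤s (s≤s economy))

    -- A capture by the travelling cop need not be claimed: the strategy wins anyway.
    approach {m} {c} {w = w} {P} {r} t t≡m wf path economy dom walk refl (_◅_ {j = v} c~v copWalk) =
      move (moveCop G c t v) (moveCop-steps G (inj₂ c~v)) (inj₂ robberMoves)
      where
      dom′ : All (Dominated G (moveCop G c t v) m) (w ∷ P)
      dom′ = All.map (Dominated-moveCop G (≤-reflexive (sym t≡m))) dom
      robberMoves : ∀ r′ → Step G r r′ → CopsWin G K (moveCop G c t v) r′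
      robberMoves r′ step with r′ ∈? w ∷ P
      ... | yes r′∈ = catch G dom′ r′∈
      ... | no r′∉  =
        approach t t≡m wf path economy dom′ (walk ◅◅ step-outside G step r′∉)
                 (moveCop-moves G c t v) copWalk

  win : Fin n → KCopsWin G K
  win v₀ = const v₀ , λ r →
    guard (<-wellFounded _) path₀ ≤-refl ((t₀ , t₀<1 , inj₁ refl) ∷ []) (t₀ , t₀<1 , refl)
          (outside-∷ G (map (_, λ ()) (connected v₀ r)))
    where
    path₀ : IsPath G (v₀ ∷ [])
    path₀ = [] ∷ [] , [-]
    t₀ : Fin K
    t₀ = freshCop 0 (bounded _ path₀)
    t₀<1 : toℕ t₀ < 1
    t₀<1 = s≤s (≤-reflexive (toℕ-freshCop 0 (bounded _ path₀)))

copNumber≤⌈p/2⌉ : ∀ {n} (G : Graph n) {p} → Connected G →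
                  (∀ xs → IsPath G xs → length xs ≤ p) → CopNumber≤ G (suc p / 2)
copNumber≤⌈p/2⌉ {zero}  G _         _       = 0 , z≤n , (λ ()) , (λ ())
copNumber≤⌈p/2⌉ {suc n} G connected bounded = _ , ≤-refl , PathGuarding.win G connected bounded Fin.zero

CopNumber≤-mono : ∀ {n} (G : Graph n) {m m′} → m ≤ m′ → CopNumber≤ G m → CopNumber≤ G m′
CopNumber≤-mono G m≤m′ (k , k≤m , win) = k , ≤-trans k≤m m≤m′ , win

theorem1p4 : (n : ℕ) (G : Graph n) (p : ℕ) →
    Connected G → LongestPathLength G p →
    CopNumber≤ G (⌈ 2 * p /3⌉ + 3)
theorem1p4 n G p connected (_ , bounded) =
  CopNumber≤-mono G (≤-trans (⌈n/2⌉≤⌈2n/3⌉ p) (m≤m+n _ 3)) (copNumber≤⌈p/2⌉ G connected bounded)
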